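{- Let $c$ be a minimal recurrent $n$-configuration and $p(c)=(n-c_1,\dots,n-c_n)$. Then $\mathcal{O}_{\mathrm{MVP}_n}(p(c))=\mathrm{CanTop}(c)$.
   Context: Abelian sandpile model on $K_n$: a configuration is $c\in\mathbb{Z}_{\ge0}^n$; toppling an unstable vertex $i$ (with $c_i\ge n$) subtracts $n$ from $c_i$ and adds $1$ to every other $c_j$. Recurrent configurations are the recurrent states of the Markov chain on stable configurations that adds a grain at a random vertex (each with positive probability) and stabilises; minimal recurrent configurations are the componentwise-minimal recurrent ones, and these are exactly the vectors $c$ that are permutations of $\{0,\dots,n-1\}$. For such $c$, $\mathrm{CanTop}(c)$ is the permutation $\pi\in S_n$ with $\pi_i$ the unique index $j$ with $c_j=n-i$. MVP parking process for $p\in[n]^n$: cars $1,\dots,n$ enter in order a one-way street with spots $1,\dots,n$; car $i$ parks in spot $p_i$, and if $p_i$ was occupied by an earlier car $j$, car $j$ is bumped and parks in the first unoccupied spot $k>p_i$ (bumped cars do not bump others). The outcome $\mathcal{O}_{\mathrm{MVP}_n}(p)$ is the permutation $\pi$ with $\pi_i$ the car in spot $i$ at the end. -}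

module Defs where

open import Data.Nat using (ℕ; zero; suc; _+_; _∸_; _≤_; _<_; _≥_; _≟_; _<?_)
open import Data.Fin using (Fin; toℕ; zero; suc)
open import Data.Fin.Properties using () renaming (_≟_ to _≟ᶠ_)
open import Data.Maybe using (Maybe; just; nothing; _>>=_)
open import Data.List using (List; []; _∷_; foldl)
open import Data.Fin.Base using () renaming (fromℕ< to fromℕ<)
open import Data.Product using (Σ; _×_; _,_; ∃)
open import Relation.Nullary using (yes; no; ¬_)
open import Relation.Binary.PropositionalEquality using (_≡_; _≢_)
open import Relation.Binary.Construct.Closure.ReflexiveTransitive using (Star)
import Data.List as L

-- Sandpile model on the complete graph K_n
-- Vertices are Fin n (vertex i+1 of the paper is index i).

Config : ℕ → Set
Config n = Fin n → ℕ

Stable : ∀ {n} → Config n → Set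
Stable {n} c = ∀ i → c i < n

data Topple {n : ℕ} (c : Config n) : Config n → Set where
  topple : (i : Fin n) → c i ≥ n →
           (d : Config n) →
           d i ≡ c i ∸ n →
           (∀ j → j ≢ i → d j ≡ suc (c j)) →
           Topple c d

Stabilises : ∀ {n} → Config n → Config n → Set
Stabilises c d = Star Topple c d × Stable d

addGrain : ∀ {n} → Config n → Fin n → Config n
addGrain c i j with i ≟ᶠ j
... | yes _ = suc (c j)
... | no _  = c j

-- One transition of the Markov chain on stable configurations:
-- add a grain at some vertex i (each has positive probability) and stabilise.
Step : ∀ {n} → Config n → Config n → Set
Step c d = Stable c × ∃ λ i → Stabilises (addGrain c i) d

Reach : ∀ {n} → Config n → Config n → Set
Reach = Star Step

Recurrent : ∀ {n} → Config n → Set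
Recurrent c = Stable c × (∀ d → Reach c d → Reach d c)

_≤ᶜ_ : ∀ {n} → Config n → Config n → Set
c ≤ᶜ d = ∀ i → c i ≤ d i

MinimalRecurrent : ∀ {n} → Config n → Set
MinimalRecurrent c = Recurrent c × (∀ d → Recurrent d → d ≤ᶜ c → d ≡ c)

-- CanTop(c) = π with π_i the unique index j with c_j = n - i  (1-based i).
-- With 0-based spot index i this reads c (π i) = n - (i+1).
IsCanTop : ∀ {n} → Config n → (Fin n → Fin n) → Set
IsCanTop {n} c π = ∀ i → c (π i) ≡ n ∸ suc (toℕ i)

-- MVP parking process.  Cars and spots are Fin n (0-based); a preference
-- is a 1-based spot number s ∈ {1,…,n}; anything else makes the process fail.

Occ : ℕ → Set
Occ n = Fin n → Maybe (Fin n)   -- car in each spot (if any)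

toSpot : (n s : ℕ) → Maybe (Fin n)
toSpot n zero = nothing
toSpot n (suc s) with s <? n
... | yes s<n = just (fromℕ< s<n)
... | no _    = nothing

update : ∀ {n} → Occ n → Fin n → Fin n → Occ n
update occ k car j with k ≟ᶠ j
... | yes _ = just car
... | no _  = occ j

firstFree : ∀ {n} → Occ n → Fin n → List (Fin n) → Maybe (Fin n)
firstFree occ k [] = nothing
firstFree occ k (j ∷ js) with toℕ k <? toℕ j | occ j
... | yes _ | nothing = just j
... | _     | _       = firstFree occ k js

mvpStep : ∀ {n} → (Fin n → ℕ) → Maybe (Occ n) → Fin n → Maybe (Occ n)
mvpStep {n} p mocc i = mocc >>= λ occ → toSpot n (p i) >>= λ k → go occ k (occ k)
  where
  go : Occ n → Fin n → Maybe (Fin n) → Maybe (Occ n)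
  go occ k nothing  = just (update occ k i)
  go occ k (just j) =
    let occ' = update occ k i in
    firstFree occ' k (L.allFin n) >>= λ k' → just (update occ' k' j)

allJust : ∀ {A : Set} (n : ℕ) → (Fin n → Maybe A) → Maybe (Fin n → A)
allJust zero f = just (λ ())
allJust (suc n) f = f zero >>= λ a → allJust n (λ j → f (suc j)) >>= λ g →
  just λ { zero → a ; (suc j) → g j }

-- Outcome: π with π_i = car in spot i (nothing if the process fails
-- or some spot stays empty).
mvpOutcome : ∀ {n} → (Fin n → ℕ) → Maybe (Fin n → Fin n)
mvpOutcome {n} p =
  foldl (mvpStep p) (just (λ _ → nothing)) (L.allFin n) >>= allJust n

prefOf : ∀ {n} → Config n → Fin n → ℕ
prefOf {n} c i = n ∸ c i

-- Dominating a permutation configuration (values 0,…,n−1 in some order) is preserved by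
-- adding grains and by toppling: toppling vertex i is absorbed by moving i to value 0 and
-- shifting the values below it up by one.  A recurrent c is reached back from the
-- all-(n−1) configuration, which dominates the identity, so c dominates some permutation
-- configuration σ.  Conversely σ is recurrent: a grain added at the vertex of value n−1 to
-- a configuration lying strictly above σ elsewhere makes every vertex topple once, in
-- decreasing order of σ, and iterating this brings the all-(n−1) configuration down to σ.
-- Minimality gives c = σ; then the MVP preferences n − σᵢ are pairwise distinct, so no
-- car is ever bumped and car i ends in spot n − σᵢ.
module Submission where

open import Defs
open import Data.Nat using (ℕ; >-nonZero; zero; suc; _+_; _∸_; _≤_; _<_; _⊓_; z≤n; s≤s; s≤s⁻¹; pred; _<?_)
open import Data.Nat.Properties
open import Data.Fin using (Fin; toℕ; zero; suc; fromℕ<; opposite; punchOut)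
open import Data.Fin.Properties using (toℕ-injective; toℕ<n; toℕ-fromℕ<; fromℕ<-toℕ; any?; punchOut-injective; opposite-prop; opposite-involutive; injective⇒≤) renaming (_≟_ to _≟ᶠ_; suc-injective to sucᶠ-injective)
open import Data.Maybe using (Maybe; just; nothing; _>>=_)
open import Data.List using (List; []; _∷_; foldl; allFin)
open import Data.List.Membership.Propositional using (_∈_)
open import Data.List.Membership.Propositional.Properties using (∈-allFin)
open import Data.List.Relation.Unary.Any using (here; there)
open import Data.List.Relation.Unary.All as All using (All; []; _∷_; universal)
open import Data.List.Relation.Unary.AllPairs using ([]; _∷_)
open import Data.List.Relation.Unary.Unique.Propositional using (Unique)
open import Data.List.Relation.Unary.Unique.Propositional.Properties using (allFin⁺)
open import Data.Product using (Σ; _×_; _,_; ∃; proj₁; proj₂)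
open import Function using (_∘_; case_of_)
open import Function.Definitions using (Injective)
open import Relation.Nullary using (yes; no; contradiction)
open import Relation.Binary.PropositionalEquality
open import Relation.Binary.Construct.Closure.ReflexiveTransitive using (Star; ε; _◅_; _◅◅_)

addGrain-same : ∀ {n} (x : Config n) i → addGrain x i i ≡ suc (x i)
addGrain-same x i with i ≟ᶠ i
... | yes _  = refl
... | no i≢i = contradiction refl i≢i

addGrain-other : ∀ {n} (x : Config n) {i j} → i ≢ j → addGrain x i j ≡ x j
addGrain-other x {i} {j} i≢j with i ≟ᶠ j
... | yes i≡j = contradiction i≡j i≢j
... | no _    = refl

x≤ᶜaddGrain : ∀ {n} (x : Config n) i → x ≤ᶜ addGrain x i
x≤ᶜaddGrain x i j with i ≟ᶠ j
... | yes _ = n≤1+n (x j)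
... | no _  = ≤-refl

addGrain≤suc : ∀ {n} (x : Config n) i j → addGrain x i j ≤ suc (x j)
addGrain≤suc x i j with i ≟ᶠ j
... | yes _ = ≤-refl
... | no _  = n≤1+n (x j)

addGrain-≤ᶜ : ∀ {n} {x T : Config n} {i} → x ≤ᶜ T → suc (x i) ≤ T i → addGrain x i ≤ᶜ T
addGrain-≤ᶜ {x = x} {i = i} x≤T sxi≤Ti j with i ≟ᶠ j
... | yes refl = sxi≤Ti
... | no _     = x≤T j

≤ᶜ-refl : ∀ {n} {x : Config n} → x ≤ᶜ x
≤ᶜ-refl _ = ≤-refl

≤ᶜ-trans : ∀ {n} {x y z : Config n} → x ≤ᶜ y → y ≤ᶜ z → x ≤ᶜ z
≤ᶜ-trans x≤y y≤z j = ≤-trans (x≤y j) (y≤z j)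

≤ᶜ-stable : ∀ {n} {x T : Config n} → Stable T → x ≤ᶜ T → Stable x
≤ᶜ-stable stT x≤T j = ≤-<-trans (x≤T j) (stT j)

reach-stable : ∀ {n} {x y : Config n} → Stable x → Reach x y → Stable y
reach-stable stX ε                        = stX
reach-stable _   ((_ , _ , _ , stY) ◅ r) = reach-stable stY r

reach-addGrain : ∀ {n} {x T : Config n} {i} → Stable T → addGrain x i ≤ᶜ T → Reach x (addGrain x i)
reach-addGrain {x = x} {i = i} stT x′≤T =
  (≤ᶜ-stable stT (≤ᶜ-trans (x≤ᶜaddGrain x i) x′≤T) , i , ε , ≤ᶜ-stable stT x′≤T) ◅ ε

module _ {n} {T : Config n} (stT : Stable T) where

  raise : ∀ m (x : Config n) j → x ≤ᶜ T → m + x j ≡ T j →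
          ∃ λ y → Reach x y × x ≤ᶜ y × y ≤ᶜ T × y j ≡ T j
  raise zero    x j x≤T xj≡Tj = x , ε , ≤ᶜ-refl , x≤T , xj≡Tj
  raise (suc m) x j x≤T m+xj≡Tj =
    let y , x′↝y , x′≤y , y≤T , yj≡Tj = raise m (addGrain x j) j x′≤T m+x′j≡Tj
    in y , reach-addGrain {i = j} stT x′≤T ◅◅ x′↝y , ≤ᶜ-trans (x≤ᶜaddGrain x j) x′≤y , y≤T , yj≡Tj
    where
    x′≤T : addGrain x j ≤ᶜ T
    x′≤T = addGrain-≤ᶜ x≤T (subst (suc (x j) ≤_) m+xj≡Tj (s≤s (m≤n+m (x j) m)))
    m+x′j≡Tj : m + addGrain x j j ≡ T j
    m+x′j≡Tj = trans (cong (m +_) (addGrain-same x j)) (trans (+-suc m (x j)) m+xj≡Tj)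

  raiseAll : ∀ (js : List (Fin n)) (x : Config n) → x ≤ᶜ T →
             ∃ λ y → Reach x y × x ≤ᶜ y × y ≤ᶜ T × (∀ {j} → j ∈ js → y j ≡ T j)
  raiseAll []       x x≤T = x , ε , ≤ᶜ-refl , x≤T , λ ()
  raiseAll (j ∷ js) x x≤T =
    let y₁ , x↝y₁ , x≤y₁ , y₁≤T , y₁j≡Tj = raise (T j ∸ x j) x j x≤T (m∸n+n≡m (x≤T j))
        y , y₁↝y , y₁≤y , y≤T , y≡T      = raiseAll js y₁ y₁≤T
    in y , x↝y₁ ◅◅ y₁↝y , ≤ᶜ-trans x≤y₁ y₁≤y , y≤T ,
       λ { (here refl) → ≤-antisym (y≤T j) (subst (_≤ y j) y₁j≡Tj (y₁≤y j))
         ; (there j∈js) → y≡T j∈js }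

  reach-upTo : ∀ (x : Config n) → x ≤ᶜ T → ∃ λ y → Reach x y × y ≗ T
  reach-upTo x x≤T =
    let y , x↝y , _ , _ , y≡T = raiseAll (allFin n) x x≤T in y , x↝y , λ j → y≡T (∈-allFin j)

m+n≡o+k⇒m≡o∸n+k : ∀ {m n o} k → m + n ≡ o + k → n ≤ o → m ≡ o ∸ n + k
m+n≡o+k⇒m≡o∸n+k {m} {n} {o} k m+n≡o+k n≤o = begin
  m             ≡⟨ sym (m+n∸n≡m m n) ⟩
  m + n ∸ n     ≡⟨ cong (_∸ n) m+n≡o+k ⟩
  o + k ∸ n     ≡⟨ +-∸-comm k n≤o ⟩
  o ∸ n + k     ∎
  where open ≡-Reasoning

toppleAt : ∀ {n} → Config n → Fin n → Config n
toppleAt {n} w v j with j ≟ᶠ v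
... | yes _ = w j ∸ n
... | no _  = suc (w j)

toppleAt-same : ∀ {n} (w : Config n) v → toppleAt w v v ≡ w v ∸ n
toppleAt-same w v with v ≟ᶠ v
... | yes _  = refl
... | no v≢v = contradiction refl v≢v

toppleAt-other : ∀ {n} (w : Config n) v j → j ≢ v → toppleAt w v j ≡ suc (w j)
toppleAt-other w v j j≢v with j ≟ᶠ v
... | yes j≡v = contradiction j≡v j≢v
... | no _    = refl

permConfig : ∀ {n} → (Fin n → Fin n) → Config n
permConfig f j = toℕ (f j)

DominatesPermutation : ∀ {n} → Config n → Set
DominatesPermutation {n} c = ∃ λ (f : Fin n → Fin n) → Injective _≡_ _≡_ f × permConfig f ≤ᶜ c

toℕ-punchOut-≤ : ∀ {N} {i j : Fin (suc N)} (i≢j : i ≢ j) → toℕ (punchOut i≢j) ≤ toℕ j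
toℕ-punchOut-≤ {_}     {zero}  {zero}  i≢j = contradiction refl i≢j
toℕ-punchOut-≤ {_}     {zero}  {suc j} _   = n≤1+n (toℕ j)
toℕ-punchOut-≤ {suc _} {suc i} {zero}  _   = z≤n
toℕ-punchOut-≤ {suc _} {suc i} {suc j} i≢j = s≤s (toℕ-punchOut-≤ (i≢j ∘ cong suc))

dominates-topple : ∀ {N} {x y : Config (suc N)} → Topple x y → DominatesPermutation x → DominatesPermutation y
dominates-topple {N} {x} {y} (topple i _ _ _ yj≡sxj) (f , f-inj , f≤x) = f′ , f′-inj , f′≤y
  where
  f′ : Fin (suc N) → Fin (suc N)
  f′ j with j ≟ᶠ i
  ... | yes _   = zero
  ... | no j≢i = suc (punchOut (j≢i ∘ sym ∘ f-inj))

  f′-inj : Injective _≡_ _≡_ f′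
  f′-inj {a} {b} f′a≡f′b with a ≟ᶠ i | b ≟ᶠ i
  ... | yes a≡i | yes b≡i = trans a≡i (sym b≡i)
  ... | no a≢i  | no b≢i  = f-inj (punchOut-injective (a≢i ∘ sym ∘ f-inj) (b≢i ∘ sym ∘ f-inj) (sucᶠ-injective f′a≡f′b))
  f′-inj () | yes _ | no _
  f′-inj () | no _  | yes _

  f′≤y : permConfig f′ ≤ᶜ y
  f′≤y j with j ≟ᶠ i
  ... | yes _   = z≤n
  ... | no j≢i rewrite yj≡sxj j j≢i = s≤s (≤-trans (toℕ-punchOut-≤ (j≢i ∘ sym ∘ f-inj)) (f≤x j))

dominates-reach : ∀ {N} {x y : Config (suc N)} → Reach x y → DominatesPermutation x → DominatesPermutation y
dominates-reach ε dom = dom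
dominates-reach {x = x} ((_ , i , topples , _) ◅ r) (f , f-inj , f≤x) =
  dominates-reach r (dominates-topples topples (f , f-inj , ≤ᶜ-trans f≤x (x≤ᶜaddGrain x i)))
  where
  dominates-topples : ∀ {u v} → Star Topple u v → DominatesPermutation u → DominatesPermutation v
  dominates-topples ε         dom = dom
  dominates-topples (t ◅ ts) dom = dominates-topples ts (dominates-topple t dom)

recurrent⇒dominates : ∀ {N} {c : Config (suc N)} → Recurrent c → DominatesPermutation c
recurrent⇒dominates {N} {c} (stC , back) =
  let d , c↝d , d≡N = reach-upTo {T = λ _ → N} (λ _ → ≤-refl) c (λ j → s≤s⁻¹ (stC j))
  in dominates-reach (back d c↝d) ((λ j → j) , (λ e → e) , λ j → subst (toℕ j ≤_) (sym (d≡N j)) (s≤s⁻¹ (toℕ<n j)))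

injective⇒surjective : ∀ {N} {f : Fin (suc N) → Fin (suc N)} → Injective _≡_ _≡_ f → ∀ k → ∃ λ j → f j ≡ k
injective⇒surjective {N} {f} f-inj k with any? (λ j → f j ≟ᶠ k)
... | yes hit = hit
... | no miss = contradiction (injective⇒≤ {f = f-avoiding-k} f-avoiding-k-inj) (<-irrefl refl)
  where
  k≢f : ∀ j → k ≢ f j
  k≢f j k≡fj = miss (j , sym k≡fj)
  f-avoiding-k : Fin (suc N) → Fin N
  f-avoiding-k j = punchOut (k≢f j)
  f-avoiding-k-inj : Injective _≡_ _≡_ f-avoiding-k
  f-avoiding-k-inj {a} {b} e = f-inj (punchOut-injective (k≢f a) (k≢f b) e)

update-same : ∀ {n} (occ : Occ n) k car → update occ k car k ≡ just car
update-same occ k car with k ≟ᶠ k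
... | yes _  = refl
... | no k≢k = contradiction refl k≢k

update-other : ∀ {n} (occ : Occ n) {k j} car → k ≢ j → update occ k car j ≡ occ j
update-other occ {k} {j} car k≢j with k ≟ᶠ j
... | yes k≡j = contradiction k≡j k≢j
... | no _    = refl

allJust-just : ∀ {A : Set} n (F : Fin n → Maybe A) (h : Fin n → A) → (∀ k → F k ≡ just (h k)) →
               ∃ λ h′ → allJust n F ≡ just h′ × h′ ≗ h
allJust-just zero    F h F≡h = _ , refl , λ ()
allJust-just (suc n) F h F≡h
  with F zero | F≡h zero | allJust-just n (F ∘ suc) (h ∘ suc) (F≡h ∘ suc)
... | _ | refl | h′ , allJust≡h′ , h′≗h rewrite allJust≡h′ =
  _ , refl , λ { zero → refl ; (suc k) → h′≗h k }

toSpot-suc-toℕ : ∀ {n} (k : Fin n) → toSpot n (suc (toℕ k)) ≡ just k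
toSpot-suc-toℕ {n} k with toℕ k <? n
... | yes k<n = cong just (fromℕ<-toℕ k k<n)
... | no k≮n  = contradiction (toℕ<n k) k≮n

module DistinctPreferences {n} (p : Fin n → ℕ) (spot : Fin n → Fin n) (spot-inj : Injective _≡_ _≡_ spot)
                           (p≡spot : ∀ i → toSpot n (p i) ≡ just (spot i)) where

  park : Occ n → Fin n → Occ n
  park occ i = update occ (spot i) i

  Free : Occ n → Fin n → Set
  Free occ i = occ (spot i) ≡ nothing

  mvpStep-free : ∀ occ i → Free occ i → mvpStep p (just occ) i ≡ just (park occ i)
  mvpStep-free occ i free rewrite p≡spot i | free = refl

  foldl-mvpStep : ∀ is occ → Unique is → All (Free occ) is → foldl (mvpStep p) (just occ) is ≡ just (foldl park occ is)
  foldl-mvpStep []       occ []          []             = refl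
  foldl-mvpStep (i ∷ is) occ (i∉is ∷ is!) (free ∷ frees) rewrite mvpStep-free occ i free =
    foldl-mvpStep is (park occ i) is! (All.zipWith stillFree (i∉is , frees))
    where
    stillFree : ∀ {j} → i ≢ j × Free occ j → Free (park occ i) j
    stillFree (i≢j , free) = trans (update-other occ i (i≢j ∘ spot-inj)) free

  foldl-park-other : ∀ is occ {k} → All (λ i → spot i ≢ k) is → foldl park occ is k ≡ occ k
  foldl-park-other []       occ []             = refl
  foldl-park-other (i ∷ is) occ (i↛k ∷ is↛k) = trans (foldl-park-other is (park occ i) is↛k) (update-other occ i i↛k)

  foldl-park-∈ : ∀ is occ {i} → Unique is → i ∈ is → foldl park occ is (spot i) ≡ just i
  foldl-park-∈ (i ∷ is) occ (i∉is ∷ _) (here refl) =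
    trans (foldl-park-other is (park occ i) (All.map (λ i≢j → i≢j ∘ sym ∘ spot-inj) i∉is)) (update-same occ (spot i) i)
  foldl-park-∈ (_ ∷ is) occ (_ ∷ is!) (there i∈is) = foldl-park-∈ is (park occ _) is! i∈is

  mvpOutcome-distinct : (spot⁻¹ : Fin n → Fin n) → (∀ k → spot (spot⁻¹ k) ≡ k) →
                        ∃ λ π → mvpOutcome p ≡ just π × π ≗ spot⁻¹
  mvpOutcome-distinct spot⁻¹ spot∘spot⁻¹ =
    let π , allJust≡π , π≗spot⁻¹ = allJust-just n final spot⁻¹ final-spot⁻¹
    in π , trans (cong (_>>= allJust n) (foldl-mvpStep (allFin n) empty (allFin⁺ n) (universal (λ _ → refl) _))) allJust≡π
         , π≗spot⁻¹
    where
    empty : Occ n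
    empty _ = nothing
    final : Occ n
    final = foldl park empty (allFin n)
    final-spot⁻¹ : ∀ k → final k ≡ just (spot⁻¹ k)
    final-spot⁻¹ k = subst (λ s → final s ≡ just (spot⁻¹ k)) (spot∘spot⁻¹ k)
                           (foldl-park-∈ (allFin n) empty (allFin⁺ n) (∈-allFin (spot⁻¹ k)))

module PermutationConfig {N : ℕ} (f : Fin (suc N) → Fin (suc N)) (f-inj : Injective _≡_ _≡_ f) where

  n : ℕ
  n = suc N

  σ : Config n
  σ = permConfig f

  σ-stable : Stable σ
  σ-stable j = toℕ<n (f j)

  σ≤N : ∀ j → σ j ≤ N
  σ≤N j = s≤s⁻¹ (σ-stable j)

  f⁻¹ : Fin n → Fin n
  f⁻¹ k = proj₁ (injective⇒surjective f-inj k)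

  f∘f⁻¹ : ∀ k → f (f⁻¹ k) ≡ k
  f∘f⁻¹ k = proj₂ (injective⇒surjective f-inj k)

  vertexOf : ∀ m → m < n → Fin n
  vertexOf m m<n = f⁻¹ (fromℕ< m<n)

  σ-vertexOf : ∀ m (m<n : m < n) → σ (vertexOf m m<n) ≡ m
  σ-vertexOf m m<n = trans (cong toℕ (f∘f⁻¹ (fromℕ< m<n))) (toℕ-fromℕ< m<n)

  σ≡⇒vertexOf : ∀ {j m} (m<n : m < n) → σ j ≡ m → j ≡ vertexOf m m<n
  σ≡⇒vertexOf m<n σj≡m =
    f-inj (trans (toℕ-injective (trans σj≡m (sym (toℕ-fromℕ< m<n)))) (sym (f∘f⁻¹ _)))

  -- w is reached after each vertex of σ-value above m has toppled once, and e after the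
  -- others follow in decreasing order of σ; the first hypothesis says that vertex j is
  -- unstable on its turn, having received one grain from each of the m − σ j before it.
  topple-descending : ∀ m (m<n : m < n) (w e : Config n) →
    (∀ j → σ j ≤ m → n + σ j ≤ w j + m) →
    (∀ j → σ j ≤ m → e j + n ≡ w j + m) →
    (∀ j → m < σ j → e j ≡ w j + suc m) →
    Star Topple w e
  topple-descending zero m<n w e unstable below above = topple v n≤wv e ev ej ◅ ε
    where
    v = vertexOf zero m<n
    σv≡0 = σ-vertexOf zero m<n
    n≤wv : n ≤ w v
    n≤wv = +-cancelʳ-≤ 0 n (w v) (subst (λ s → n + s ≤ w v + 0) σv≡0 (unstable v (≤-reflexive σv≡0)))
    ev : e v ≡ w v ∸ n
    ev = trans (m+n≡o+k⇒m≡o∸n+k 0 (below v (≤-reflexive σv≡0)) n≤wv) (+-identityʳ _)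
    ej : ∀ j → j ≢ v → e j ≡ suc (w j)
    ej j j≢v = trans (above j (n≢0⇒n>0 (j≢v ∘ σ≡⇒vertexOf m<n))) (+-comm (w j) 1)
  topple-descending (suc m) m<n w e unstable below above =
    topple v n≤wv w₁ (toppleAt-same w v) (toppleAt-other w v) ◅
    topple-descending m (<-trans (n<1+n m) m<n) w₁ e unstable₁ below₁ above₁
    where
    v = vertexOf (suc m) m<n
    σv≡1+m = σ-vertexOf (suc m) m<n
    n≤wv : n ≤ w v
    n≤wv = +-cancelʳ-≤ (suc m) n (w v) (subst (λ s → n + s ≤ w v + suc m) σv≡1+m (unstable v (≤-reflexive σv≡1+m)))
    w₁ = toppleAt w v
    w₁+k : ∀ j k → j ≢ v → w₁ j + k ≡ w j + suc k
    w₁+k j k j≢v = trans (cong (_+ k) (toppleAt-other w v j j≢v)) (sym (+-suc (w j) k))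
    ≢v : ∀ {j} → σ j ≤ m → j ≢ v
    ≢v σj≤m refl = 1+n≰n (subst (_≤ m) σv≡1+m σj≤m)
    unstable₁ : ∀ j → σ j ≤ m → n + σ j ≤ w₁ j + m
    unstable₁ j σj≤m = subst (n + σ j ≤_) (sym (w₁+k j m (≢v σj≤m))) (unstable j (m≤n⇒m≤1+n σj≤m))
    below₁ : ∀ j → σ j ≤ m → e j + n ≡ w₁ j + m
    below₁ j σj≤m = trans (below j (m≤n⇒m≤1+n σj≤m)) (sym (w₁+k j m (≢v σj≤m)))
    above₁ : ∀ j → m < σ j → e j ≡ w₁ j + suc m
    above₁ j m<σj = case j ≟ᶠ v of λ where
      (yes j≡v) → subst (λ u → e u ≡ w₁ u + suc m) (sym j≡v)
                    (trans (m+n≡o+k⇒m≡o∸n+k (suc m) (below v (≤-reflexive σv≡1+m)) n≤wv)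
                           (cong (_+ suc m) (sym (toppleAt-same w v))))
      (no j≢v)  → trans (above j (≤∧≢⇒< m<σj (j≢v ∘ σ≡⇒vertexOf m<n ∘ sym))) (sym (w₁+k j (suc m) j≢v))

  topple-all : (y e : Config n) → (∀ j → σ j < y j) → (∀ j → suc (e j) ≡ y j) → Star Topple y e
  topple-all y e σ<y e+1≡y = topple-descending N (n<1+n N) y e unstable below (λ j N<σj → contradiction (σ≤N j) (<⇒≱ N<σj))
    where
    unstable : ∀ j → σ j ≤ N → n + σ j ≤ y j + N
    unstable j _ = begin
      suc N + σ j   ≡⟨ sym (+-suc N (σ j)) ⟩
      N + suc (σ j) ≤⟨ +-monoʳ-≤ N (σ<y j) ⟩
      N + y j       ≡⟨ +-comm N (y j) ⟩
      y j + N       ∎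
      where open ≤-Reasoning
    below : ∀ j → σ j ≤ N → e j + n ≡ y j + N
    below j _ = trans (+-suc (e j) N) (cong (_+ N) (e+1≡y j))

  top : Fin n
  top = vertexOf N (n<1+n N)

  σ-top : σ top ≡ N
  σ-top = σ-vertexOf N (n<1+n N)

  σ<N : ∀ {j} → j ≢ top → σ j < N
  σ<N j≢top = ≤∧≢⇒< (σ≤N _) (j≢top ∘ σ≡⇒vertexOf (n<1+n N))

  -- ladder (suc N) is constantly n − 1; a step-down followed by refilling lowers
  -- ladder (suc (suc t)) to ladder (suc t), and a step-down from ladder 1 lands on σ.
  ladder : ℕ → Config n
  ladder t j = N ⊓ (σ j + t)

  ladder-stable : ∀ t → Stable (ladder t)
  ladder-stable t j = s≤s (m⊓n≤m N (σ j + t))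

  ladder-top : ∀ t → ladder t top ≡ N
  ladder-top t = m≤n⇒m⊓n≡m (subst (_≤ σ top + t) σ-top (m≤m+n (σ top) t))

  σ<ladder : ∀ t {j} → j ≢ top → σ j < ladder (suc t) j
  σ<ladder t {j} j≢top = ⊓-glb (σ<N j≢top) (subst (σ j <_) (sym (+-suc (σ j) t)) (s≤s (m≤m+n (σ j) t)))

  σ<addGrain-top : ∀ t {x} → x ≗ ladder (suc t) → ∀ j → σ j < addGrain x top j
  σ<addGrain-top t {x} x≗ j with j ≟ᶠ top
  ... | yes refl = subst₂ _<_ (sym σ-top) (sym (trans (addGrain-same x j) (cong suc (trans (x≗ j) (ladder-top (suc t))))))
                           (n<1+n N)
  ... | no j≢top = subst (σ j <_) (sym (trans (addGrain-other x (j≢top ∘ sym)) (x≗ j))) (σ<ladder t j≢top)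

  step-down : ∀ t {x} → x ≗ ladder (suc t) → (e : Config n) → Stable e →
              (∀ j → suc (e j) ≡ addGrain x top j) → Step x e
  step-down t {x} x≗ e stE e+1≡y =
    stX , top , topple-all (addGrain x top) e (σ<addGrain-top t x≗) e+1≡y , stE
    where
    stX : Stable x
    stX j = subst (_< n) (sym (x≗ j)) (ladder-stable (suc t) j)

  ladder-reach : ∀ t {x} → x ≗ ladder (suc t) → Reach x σ
  ladder-reach zero {x} x≗ = step-down zero x≗ σ σ-stable σ+1≡y ◅ ε
    where
    σ+1≡y : ∀ j → suc (σ j) ≡ addGrain x top j
    σ+1≡y j with j ≟ᶠ top
    ... | yes refl = sym (trans (addGrain-same x j) (cong suc (trans (x≗ j) (trans (ladder-top 1) (sym σ-top)))))
    ... | no j≢top = sym (trans (addGrain-other x (j≢top ∘ sym))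
                                (trans (x≗ j) (trans (m≥n⇒m⊓n≡n (subst (_≤ N) (+-comm 1 (σ j)) (σ<N j≢top)))
                                                     (+-comm (σ j) 1))))
  ladder-reach (suc t) {x} x≗ =
    let x′ , e↝x′ , x′≗ = reach-upTo (ladder-stable (suc t)) e e≤ladder
    in step-down (suc t) x≗ e (≤ᶜ-stable (ladder-stable (suc t)) e≤ladder) e+1≡y ◅ (e↝x′ ◅◅ ladder-reach t x′≗)
    where
    e : Config n
    e j = pred (addGrain x top j)
    e+1≡y : ∀ j → suc (e j) ≡ addGrain x top j
    e+1≡y j = suc-pred (addGrain x top j) {{>-nonZero (≤-<-trans z≤n (σ<addGrain-top (suc t) x≗ j))}}
    y≤ : ∀ j → addGrain x top j ≤ suc (σ j + suc t)
    y≤ j with j ≟ᶠ top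
    ... | yes refl = ≤-trans (≤-reflexive (trans (addGrain-same x j) (cong suc (trans (x≗ j) (trans (ladder-top _) (sym σ-top))))))
                             (s≤s (m≤m+n (σ j) (suc t)))
    ... | no j≢top = ≤-trans (≤-reflexive (trans (addGrain-other x (j≢top ∘ sym)) (x≗ j)))
                             (≤-trans (m⊓n≤n N _) (≤-reflexive (+-suc (σ j) (suc t))))
    e≤ladder : e ≤ᶜ ladder (suc t)
    e≤ladder j = ⊓-glb (pred-mono-≤ (≤-trans (addGrain≤suc x top j) (s≤s (≤-trans (≤-reflexive (x≗ j)) (m⊓n≤m N _)))))
                       (pred-mono-≤ (y≤ j))

  recurrent : Recurrent σ
  recurrent = σ-stable , λ d σ↝d →
    let d≤N j = s≤s⁻¹ (reach-stable σ-stable σ↝d j)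
        x , d↝x , x≗ = reach-upTo (ladder-stable (suc N)) d
                         (λ j → ⊓-glb (d≤N j) (≤-trans (d≤N j) (≤-trans (n≤1+n N) (m≤n+m (suc N) (σ j)))))
    in d↝x ◅◅ ladder-reach N x≗

  -- Car i prefers the (1-based) spot n − σ i, which is the 0-based spot opposite (f i).
  spot : Fin n → Fin n
  spot i = opposite (f i)

  spot-inj : Injective _≡_ _≡_ spot
  spot-inj {a} {b} spot-a≡spot-b =
    f-inj (trans (sym (opposite-involutive (f a))) (trans (cong opposite spot-a≡spot-b) (opposite-involutive (f b))))

  spot⁻¹ : Fin n → Fin n
  spot⁻¹ k = f⁻¹ (opposite k)

  spot∘spot⁻¹ : ∀ k → spot (spot⁻¹ k) ≡ k
  spot∘spot⁻¹ k = trans (cong opposite (f∘f⁻¹ (opposite k))) (opposite-involutive k)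

  prefOf≡spot : ∀ i → toSpot n (prefOf σ i) ≡ just (spot i)
  prefOf≡spot i = begin
    toSpot n (suc N ∸ σ i)          ≡⟨ cong (toSpot n) (+-∸-assoc 1 (σ≤N i)) ⟩
    toSpot n (suc (N ∸ σ i))        ≡⟨ cong (toSpot n ∘ suc) (sym (opposite-prop (f i))) ⟩
    toSpot n (suc (toℕ (spot i)))   ≡⟨ toSpot-suc-toℕ (spot i) ⟩
    just (spot i)                   ∎
    where open ≡-Reasoning

  mvpOutcome-canTop : ∃ λ π → mvpOutcome (prefOf σ) ≡ just π × IsCanTop σ π
  mvpOutcome-canTop =
    let π , outcome≡π , π≗spot⁻¹ = mvpOutcome-distinct spot⁻¹ spot∘spot⁻¹
    in π , outcome≡π , λ i → begin
      σ (π i)                    ≡⟨ cong σ (π≗spot⁻¹ i) ⟩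
      toℕ (f (f⁻¹ (opposite i))) ≡⟨ cong toℕ (f∘f⁻¹ (opposite i)) ⟩
      toℕ (opposite i)           ≡⟨ opposite-prop i ⟩
      n ∸ suc (toℕ i)            ∎
    where
    open DistinctPreferences (prefOf σ) spot spot-inj prefOf≡spot
    open ≡-Reasoning

lemma5p11 : (n : ℕ) (c : Config n) → MinimalRecurrent c →
    Σ (Fin n → Fin n) (λ π → (mvpOutcome (prefOf c) ≡ just π) × IsCanTop c π)
lemma5p11 zero    c _                     = (λ ()) , refl , λ ()
lemma5p11 (suc N) c (c-recurrent , minimal) with recurrent⇒dominates c-recurrent
... | f , f-inj , f≤c with minimal (permConfig f) (PermutationConfig.recurrent f f-inj) f≤c
... | refl = PermutationConfig.mvpOutcome-canTop f f-inj
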